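{- Suppose that there exist infinitely many primes $p$ such that there is no prime between $(p-1)^2$ and $p^2$. Then $M(x) - \pi(x) \to \infty$ as $x \to \infty$.
   Context: $\varphi$ denotes the Euler totient function, $[x] = \{n\in\mathbb{N}: n\le x\}$, and $M(x)$ is the largest cardinality of a subset $S \subseteq [x]$ on which $\varphi$ is nondecreasing ($\varphi(n)\le\varphi(m)$ whenever $n\le m$ are in $S$). $\pi(x)$ is the number of primes $\le x$. -}

module Defs where

open import Data.Nat using (ℕ; zero; suc; _≤_; _≤?_; _⊔_)
open import Data.Nat.Coprimality using (coprime?)
open import Data.Nat.Primality using (prime?)
open import Data.Bool using (true; false)
open import Data.Fin using (Fin; toℕ)
open import Data.Fin.Properties using (all?)
open import Data.Fin.Subset using (Subset; _∈_; ∣_∣)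
open import Data.Fin.Subset.Properties using (_∈?_)
open import Data.List using (List; []; _∷_; map; filter; length; upTo; foldr; _++_)
open import Data.Vec using (_∷_; [])
open import Relation.Nullary using (Dec; yes; no)
open import Relation.Nullary.Decidable using (_→-dec_)

range1 : ℕ → List ℕ
range1 x = map suc (upTo x)

φ : ℕ → ℕ
φ n = length (filter (λ k → coprime? k n) (range1 n))

π : ℕ → ℕ
π x = length (filter prime? (range1 x))

-- A subset S ⊆ [x] is encoded as S : Subset x, where i ∈ S means (toℕ i + 1) ∈ S.
-- φ is nondecreasing on S: n ≤ m in S implies φ n ≤ φ m.
NonDecOn : ∀ {x} → Subset x → Set
NonDecOn {x} S = ∀ (i j : Fin x) → i ∈ S → j ∈ S →
  suc (toℕ i) ≤ suc (toℕ j) → φ (suc (toℕ i)) ≤ φ (suc (toℕ j))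

nonDecOn? : ∀ {x} (S : Subset x) → Dec (NonDecOn S)
nonDecOn? S = all? λ i → all? λ j →
  (i ∈? S) →-dec ((j ∈? S) →-dec ((_ ≤? _) →-dec (_ ≤? _)))

allSubsets : (x : ℕ) → List (Subset x)
allSubsets zero = [] ∷ []
allSubsets (suc x) = map (true ∷_) (allSubsets x) ++ map (false ∷_) (allSubsets x)

maximum : List ℕ → ℕ
maximum = foldr _⊔_ 0

M : ℕ → ℕ
M x = maximum (map ∣_∣ (filter nonDecOn? (allSubsets x)))

-- φ p = p − 1 on primes, so φ is nondecreasing on the primes and M x ≥ π x.
-- Let p be a prime with no prime in ((p − 1)², p²). Every prime n < p² then
-- satisfies φ n ≤ n ≤ (p − 1)² ≤ φ (p²), and every prime m > p² satisfies
-- φ (p²) ≤ p² ≤ m − 1 = φ m; so p² can be added to any φ-monotone set whose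
-- non-prime elements are at most (p − 1)². Adding, one after another, the
-- squares of B such primes, each beyond all squares added before, gives a
-- φ-monotone set with π x + B elements in [x] once x passes the last square.
module Submission where

open import Defs
open import Data.Bool using (true; false)
open import Data.Fin using (Fin; toℕ)
open import Data.Fin.Subset using (Subset; ∣_∣)
import Data.Fin.Subset as Subset
open import Data.List using (List; []; _∷_; [_]; map; filter; length; upTo; _++_)
open import Data.List.Membership.Propositional using (_∈_)
open import Data.List.Membership.Propositional.Properties using (∈-map⁺; ∈-++⁺ˡ; ∈-++⁺ʳ; ∈-filter⁺)
open import Data.List.Properties using (upTo-∷ʳ; map-++; map-upTo; filter-++; filter-accept; filter-reject; length-++; length-map; length-upTo; length-filter)
open import Data.List.Relation.Unary.Any using (here; there)
open import Data.Nat using (ℕ; zero; suc; _+_; _*_; _∸_; _^_; _≤_; _<_; _⊔_; z≤n; s≤s; _≟_; >-nonZero)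
open import Data.Nat.Coprimality using (Coprime; coprime?; prime⇒coprime; coprime-divisor)
import Data.Nat.Coprimality as Coprime
open import Data.Nat.Divisibility using (_∣_; _∣?_; ∣-refl; ∣-trans; ∣⇒≤; ∣m+n∣m⇒∣n; n∣m*n; m∣m*n)
open import Data.Nat.Primality using (Prime; prime?; ¬prime[0]; ¬prime[1]; prime⇒irreducible; prime⇒nonZero)
open import Data.Nat.Properties
open import Data.Product using (_,_; _×_; ∃-syntax)
open import Data.Sum using (_⊎_; inj₁; inj₂; map₁)
open import Data.Vec using (tabulate) renaming (_∷_ to _∷ᵥ_; [] to []ᵥ)
open import Data.Vec.Properties using ([]=⇒lookup; lookup∘tabulate)
open import Level using (Level; 0ℓ)
open import Relation.Binary.PropositionalEquality using (_≡_; refl; sym; trans; cong; subst; module ≡-Reasoning)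
open import Relation.Nullary using (¬_; does; yes; no; contradiction)
open import Relation.Nullary.Decidable using (¬?)
open import Relation.Unary using (Pred; Decidable; _⊆_; _∪_; ｛_｝)
open import Relation.Unary.Properties using (_∪?_)

private variable
  ℓ : Level
  P Q : Pred ℕ ℓ
  a c s x : ℕ

count : Decidable P → ℕ → ℕ
count P? x = length (filter P? (range1 x))

range1-suc : ∀ x → range1 (suc x) ≡ range1 x ++ [ suc x ]
range1-suc x = trans (cong (map suc) (sym (upTo-∷ʳ x))) (map-++ suc (upTo x) [ x ])

range1-suc′ : ∀ x → range1 (suc x) ≡ 1 ∷ map suc (range1 x)
range1-suc′ x = cong (λ xs → 1 ∷ map suc xs) (sym (map-upTo suc x))

length-filter-map : (P? : Decidable P) (f : ℕ → ℕ) (xs : List ℕ) →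
  length (filter P? (map f xs)) ≡ length (filter (λ n → P? (f n)) xs)
length-filter-map P? f [] = refl
length-filter-map P? f (x ∷ xs) with P? (f x)
... | yes _ = cong suc (length-filter-map P? f xs)
... | no _ = length-filter-map P? f xs

count≤ : (P? : Decidable P) (x : ℕ) → count P? x ≤ x
count≤ P? x = ≤-trans (length-filter P? (range1 x))
  (≤-reflexive (trans (length-map suc (upTo x)) (length-upTo x)))

count-suc : (P? : Decidable P) (x : ℕ) →
  count P? (suc x) ≡ count P? x + length (filter P? [ suc x ])
count-suc P? x = begin
  length (filter P? (range1 (suc x)))                  ≡⟨ cong (λ xs → length (filter P? xs)) (range1-suc x) ⟩
  length (filter P? (range1 x ++ [ suc x ]))           ≡⟨ cong length (filter-++ P? (range1 x) [ suc x ]) ⟩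
  length (filter P? (range1 x) ++ filter P? [ suc x ]) ≡⟨ length-++ (filter P? (range1 x)) ⟩
  count P? x + length (filter P? [ suc x ])            ∎
  where open ≡-Reasoning

count-suc-yes : (P? : Decidable P) → P (suc x) → count P? (suc x) ≡ suc (count P? x)
count-suc-yes {x = x} P? Px = trans (count-suc P? x)
  (trans (cong (λ xs → count P? x + length xs) (filter-accept P? Px)) (+-comm (count P? x) 1))

count-suc-no : (P? : Decidable P) → ¬ P (suc x) → count P? (suc x) ≡ count P? x
count-suc-no {x = x} P? ¬Px = trans (count-suc P? x)
  (trans (cong (λ xs → count P? x + length xs) (filter-reject P? ¬Px)) (+-identityʳ (count P? x)))

count-shift : (P? : Decidable P) (x : ℕ) →
  count P? (suc x) ≡ length (filter P? [ 1 ]) + count (λ n → P? (suc n)) x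
count-shift P? x = begin
  length (filter P? (range1 (suc x)))
    ≡⟨ cong (λ xs → length (filter P? xs)) (range1-suc′ x) ⟩
  length (filter P? ([ 1 ] ++ map suc (range1 x)))
    ≡⟨ cong length (filter-++ P? [ 1 ] (map suc (range1 x))) ⟩
  length (filter P? [ 1 ] ++ filter P? (map suc (range1 x)))
    ≡⟨ length-++ (filter P? [ 1 ]) ⟩
  length (filter P? [ 1 ]) + length (filter P? (map suc (range1 x)))
    ≡⟨ cong (length (filter P? [ 1 ]) +_) (length-filter-map P? suc (range1 x)) ⟩
  length (filter P? [ 1 ]) + count (λ n → P? (suc n)) x
    ∎
  where open ≡-Reasoning

count-step : ∀ {k} (P? : Decidable P) (Q? : Decidable Q) → (P (suc x) → Q (suc x)) →
  k + count P? x ≤ count Q? x → k + count P? (suc x) ≤ count Q? (suc x)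
count-step {x = x} {k} P? Q? P⇒Q le with P? (suc x)
... | yes Px rewrite count-suc-yes P? Px | count-suc-yes Q? (P⇒Q Px) | +-suc k (count P? x) = s≤s le
... | no ¬Px rewrite count-suc-no P? ¬Px =
  ≤-trans le (≤-trans (m≤m+n (count Q? x) _) (≤-reflexive (sym (count-suc Q? x))))

count-mono-⊆ : (P? : Decidable P) (Q? : Decidable Q) → P ⊆ Q → ∀ x → count P? x ≤ count Q? x
count-mono-⊆ P? Q? P⊆Q zero = z≤n
count-mono-⊆ P? Q? P⊆Q (suc x) = count-step P? Q? P⊆Q (count-mono-⊆ P? Q? P⊆Q x)

count-insert : (P? : Decidable P) → ¬ P s → 1 ≤ s → s ≤ x →
  suc (count P? x) ≤ count (P? ∪? (s ≟_)) x
count-insert {x = zero} P? ¬Ps (s≤s _) ()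
count-insert {s = s} {x = suc x} P? ¬Ps 1≤s s≤1+x with m≤n⇒m<n∨m≡n s≤1+x
... | inj₁ (s≤s s≤x) = count-step P? (P? ∪? (s ≟_)) inj₁ (count-insert P? ¬Ps 1≤s s≤x)
... | inj₂ refl rewrite count-suc-no P? ¬Ps | count-suc-yes (P? ∪? (s ≟_)) (inj₂ refl) =
  s≤s (count-mono-⊆ P? (P? ∪? (s ≟_)) inj₁ x)

count-run : (P? : Decidable P) → (∀ {k} → a < k → k ≤ a + c → P k) →
  count P? (a + c) ≡ count P? a + c
count-run {a = a} {c = zero} P? run = trans (cong (count P?) (+-identityʳ a)) (sym (+-identityʳ _))
count-run {a = a} {c = suc c} P? run = begin
  count P? (a + suc c)   ≡⟨ cong (count P?) (+-suc a c) ⟩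
  count P? (suc (a + c)) ≡⟨ count-suc-yes P? (run (s≤s (m≤m+n a c)) (≤-reflexive (sym (+-suc a c)))) ⟩
  suc (count P? (a + c)) ≡⟨ cong suc (count-run P? (λ a<k k≤a+c → run a<k (≤-trans k≤a+c (+-monoʳ-≤ a (n≤1+n c))))) ⟩
  suc (count P? a + c)   ≡⟨ sym (+-suc (count P? a) c) ⟩
  count P? a + suc c     ∎
  where open ≡-Reasoning

_MonotoneOn_ : (ℕ → ℕ) → Pred ℕ ℓ → Set ℓ
f MonotoneOn P = ∀ {m n} → P m → P n → m ≤ n → f m ≤ f n

monotoneOn-insert : ∀ {f : ℕ → ℕ} → f MonotoneOn P →
  (∀ {n} → P n → n ≤ s → f n ≤ f s) → (∀ {m} → P m → s ≤ m → f s ≤ f m) →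
  f MonotoneOn (P ∪ ｛ s ｝)
monotoneOn-insert mono below above (inj₁ Pn) (inj₁ Pm) = mono Pn Pm
monotoneOn-insert mono below above (inj₁ Pn) (inj₂ refl) = below Pn
monotoneOn-insert mono below above (inj₂ refl) (inj₁ Pm) = above Pm
monotoneOn-insert mono below above (inj₂ refl) (inj₂ refl) _ = ≤-refl

toSubset : ∀ {x} → Decidable P → Subset x
toSubset P? = tabulate (λ i → does (P? (suc (toℕ i))))

∣toSubset∣≡count : (P? : Decidable P) (x : ℕ) → ∣ toSubset {x = x} P? ∣ ≡ count P? x
∣toSubset∣≡count P? zero = refl
∣toSubset∣≡count P? (suc x) rewrite count-shift P? x with P? 1 | ∣toSubset∣≡count (λ n → P? (suc n)) x
... | yes _ | ih = cong suc ih
... | no _  | ih = ih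

∈toSubset⇒ : (P? : Decidable P) {i : Fin x} → i Subset.∈ toSubset P? → P (suc (toℕ i))
∈toSubset⇒ P? {i} i∈ with P? (suc (toℕ i)) | trans (sym (lookup∘tabulate _ i)) ([]=⇒lookup i∈)
... | yes Pi | _ = Pi
... | no _ | ()

toSubset-nonDec : (P? : Decidable P) → φ MonotoneOn P → NonDecOn (toSubset {x = x} P?)
toSubset-nonDec P? mono i j i∈ j∈ = mono (∈toSubset⇒ P? i∈) (∈toSubset⇒ P? j∈)

∈allSubsets : ∀ x (S : Subset x) → S ∈ allSubsets x
∈allSubsets zero []ᵥ = here refl
∈allSubsets (suc x) (true ∷ᵥ S) = ∈-++⁺ˡ (∈-map⁺ (true ∷ᵥ_) (∈allSubsets x S))
∈allSubsets (suc x) (false ∷ᵥ S) = ∈-++⁺ʳ _ (∈-map⁺ (false ∷ᵥ_) (∈allSubsets x S))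

≤maximum : ∀ {n xs} → n ∈ xs → n ≤ maximum xs
≤maximum (here refl) = m≤m⊔n _ _
≤maximum {xs = y ∷ ys} (there n∈ys) = ≤-trans (≤maximum n∈ys) (m≤n⊔m y (maximum ys))

count≤M : (P? : Decidable P) → φ MonotoneOn P → ∀ x → count P? x ≤ M x
count≤M P? mono x = subst (_≤ M x) (∣toSubset∣≡count P? x)
  (≤maximum (∈-map⁺ ∣_∣ (∈-filter⁺ nonDecOn? (∈allSubsets x (toSubset P?)) (toSubset-nonDec P? mono))))

squared : ∀ n → n ^ 2 ≡ n * n
squared n = cong (n *_) (*-identityʳ n)

n≤n^2 : ∀ n → n ≤ n ^ 2
n≤n^2 zero = z≤n
n≤n^2 (suc n) = m≤m*n (suc n) (suc n ^ 1)

φ≤ : ∀ n → φ n ≤ n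
φ≤ n = count≤ (λ k → coprime? k n) n

φ-prime : ∀ {p} → Prime p → φ p ≡ p ∸ 1
φ-prime {zero} pp = contradiction pp ¬prime[0]
φ-prime {suc m} pp = begin
  φ (suc m)                          ≡⟨ count-suc-no (λ k → coprime? k (suc m)) ¬coprime-self ⟩
  count (λ k → coprime? k (suc m)) m ≡⟨ count-run {a = 0} (λ k → coprime? k (suc m)) coprime-below ⟩
  m                                  ∎
  where
  open ≡-Reasoning
  ¬coprime-self : ¬ Coprime (suc m) (suc m)
  ¬coprime-self c = ¬prime[1] (subst Prime (c (∣-refl , ∣-refl)) pp)
  coprime-below : ∀ {k} → 0 < k → k ≤ m → Coprime k (suc m)
  coprime-below {suc k} _ k≤m = Coprime.sym (prime⇒coprime pp (s≤s k≤m))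

∤-between-multiples : ∀ q a {k} → a * suc q < k → k ≤ a * suc q + q → ¬ suc q ∣ k
∤-between-multiples q a {k} lo hi d∣k = <⇒≱ (s≤s r≤q) (∣⇒≤ {{>-nonZero 0<r}} d∣r)
  where
  r = k ∸ a * suc q
  0<r : 0 < r
  0<r = m<n⇒0<n∸m lo
  r≤q : r ≤ q
  r≤q = ≤-trans (∸-monoˡ-≤ (a * suc q) hi) (≤-reflexive (m+n∸m≡n (a * suc q) q))
  d∣r : suc q ∣ r
  d∣r = ∣m+n∣m⇒∣n (subst (suc q ∣_) (sym (m+[n∸m]≡n (<⇒≤ lo))) d∣k) (n∣m*n a)

count-nonMultiples : ∀ q a → count (λ k → ¬? (suc q ∣? k)) (a * suc q) ≡ a * q
count-nonMultiples q zero = refl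
count-nonMultiples q (suc a) = begin
  count ∤? (suc q + a * suc q)   ≡⟨ cong (count ∤?) (cong suc (+-comm q (a * suc q))) ⟩
  count ∤? (suc (a * suc q + q)) ≡⟨ count-suc-no ∤? (λ ∤next → ∤next ∣next) ⟩
  count ∤? (a * suc q + q)       ≡⟨ count-run ∤? (∤-between-multiples q a) ⟩
  count ∤? (a * suc q) + q       ≡⟨ cong (_+ q) (count-nonMultiples q a) ⟩
  a * q + q                      ≡⟨ +-comm (a * q) q ⟩
  suc a * q                      ∎
  where
  open ≡-Reasoning
  ∤? : Decidable (λ k → ¬ suc q ∣ k)
  ∤? k = ¬? (suc q ∣? k)
  ∣next : suc q ∣ suc (a * suc q + q)
  ∣next = subst (suc q ∣_) (cong suc (+-comm q (a * suc q))) (n∣m*n (suc a))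

coprime-square : ∀ {p k} → Prime p → ¬ p ∣ k → Coprime k (p * p)
coprime-square {p} {k} pp p∤k (d∣k , d∣p*p) = coprime-p d∣k (∣-refl , coprime-divisor (coprime-p d∣k) d∣p*p)
  where
  coprime-p : ∀ {n} → n ∣ k → Coprime n p
  coprime-p n∣k {e} (e∣n , e∣p) with prime⇒irreducible pp e∣p
  ... | inj₁ e≡1 = e≡1
  ... | inj₂ refl = contradiction (∣-trans e∣n n∣k) p∤k

¬prime-square : ∀ {p} → Prime p → ¬ Prime (p ^ 2)
¬prime-square {p} pp psq with prime⇒irreducible psq (m∣m*n (p ^ 1))
... | inj₁ p≡1 = ¬prime[1] (subst Prime p≡1 pp)
... | inj₂ p≡p² = ¬prime[1] (subst Prime (sym 1≡p) pp)
  where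
  instance _ = prime⇒nonZero pp
  1≡p : 1 ≡ p
  1≡p = *-cancelˡ-≡ 1 p p (trans (*-identityʳ p) (trans p≡p² (squared p)))

φ-square≥ : ∀ {p} → Prime p → (p ∸ 1) ^ 2 ≤ φ (p ^ 2)
φ-square≥ {zero} pp = contradiction pp ¬prime[0]
φ-square≥ {suc q} pp = begin
  q ^ 2                                         ≡⟨ squared q ⟩
  q * q                                         ≤⟨ *-monoˡ-≤ q (n≤1+n q) ⟩
  suc q * q                                     ≡⟨ sym (count-nonMultiples q (suc q)) ⟩
  count (λ k → ¬? (suc q ∣? k)) (suc q * suc q) ≤⟨ count-mono-⊆ (λ k → ¬? (suc q ∣? k)) (λ k → coprime? k (suc q * suc q))
                                                                (coprime-square pp) (suc q * suc q) ⟩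
  φ (suc q * suc q)                             ≡⟨ cong φ (sym (squared (suc q))) ⟩
  φ (suc q ^ 2)                                 ∎
  where open ≤-Reasoning

NoPrimeBetween : ℕ → ℕ → Set
NoPrimeBetween a b = ∀ q → a < q → q < b → ¬ Prime q

φ≤φ-square : ∀ {p n} → Prime p → NoPrimeBetween ((p ∸ 1) ^ 2) (p ^ 2) →
  n ≤ (p ∸ 1) ^ 2 ⊎ Prime n → n ≤ p ^ 2 → φ n ≤ φ (p ^ 2)
φ≤φ-square {p} {n} pp gap small-or-prime n≤p² =
  ≤-trans (φ≤ n) (≤-trans (n≤[p-1]² small-or-prime) (φ-square≥ pp))
  where
  n≤[p-1]² : n ≤ (p ∸ 1) ^ 2 ⊎ Prime n → n ≤ (p ∸ 1) ^ 2
  n≤[p-1]² (inj₁ n≤) = n≤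
  n≤[p-1]² (inj₂ pn) = ≮⇒≥ λ lt → gap n lt n<p² pn
    where
    n<p² : n < p ^ 2
    n<p² = ≤∧≢⇒< n≤p² λ { refl → ¬prime-square pp pn }

φ-square≤φ : ∀ {p m} → Prime p → Prime m → p ^ 2 ≤ m → φ (p ^ 2) ≤ φ m
φ-square≤φ {p} {m} pp pm p²≤m = begin
  φ (p ^ 2) ≤⟨ φ≤ (p ^ 2) ⟩
  p ^ 2     ≤⟨ ≤-pred (≤-trans p²<m (≤-reflexive (sym (suc-pred m)))) ⟩
  m ∸ 1     ≡⟨ sym (φ-prime pm) ⟩
  φ m       ∎
  where
  open ≤-Reasoning
  instance _ = prime⇒nonZero pm
  p²<m : p ^ 2 < m
  p²<m = ≤∧≢⇒< p²≤m λ { refl → ¬prime-square pp pm }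

record MonotoneExcess (B : ℕ) : Set₁ where
  field
    S                : Pred ℕ 0ℓ
    S?               : Decidable S
    φ-monotone       : φ MonotoneOn S
    bound            : ℕ
    bounded-or-prime : ∀ {n} → S n → n ≤ bound ⊎ Prime n
    threshold        : ℕ
    excess           : ∀ {x} → threshold ≤ x → π x + B ≤ count S? x

open MonotoneExcess

primes : MonotoneExcess 0
primes = record
  { S = Prime ; S? = prime? ; φ-monotone = φ-monotone-primes
  ; bound = 0 ; bounded-or-prime = inj₂
  ; threshold = 0 ; excess = λ {x} _ → ≤-reflexive (+-identityʳ (π x)) }
  where
  φ-monotone-primes : φ MonotoneOn Prime
  φ-monotone-primes pm pn m≤n rewrite φ-prime pm | φ-prime pn = ∸-monoˡ-≤ 1 m≤n

insert-square : ∀ {B p} (E : MonotoneExcess B) → bound E < p → Prime p →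
  NoPrimeBetween ((p ∸ 1) ^ 2) (p ^ 2) → MonotoneExcess (suc B)
insert-square {B} {p} E K<p pp gap = record
  { S = S E ∪ ｛ p ^ 2 ｝ ; S? = S? E ∪? (p ^ 2 ≟_)
  ; φ-monotone = monotoneOn-insert (φ-monotone E) below above
  ; bound = p ^ 2 ; bounded-or-prime = bounded-or-prime′
  ; threshold = threshold E ⊔ p ^ 2 ; excess = excess′ }
  where
  instance _ = prime⇒nonZero pp
  K<p² : bound E < p ^ 2
  K<p² = <-≤-trans K<p (n≤n^2 p)
  K≤[p-1]² : bound E ≤ (p ∸ 1) ^ 2
  K≤[p-1]² = ≤-trans (≤-pred (≤-trans K<p (≤-reflexive (sym (suc-pred p))))) (n≤n^2 (p ∸ 1))
  p²∉S : ¬ S E (p ^ 2)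
  p²∉S p²∈S with bounded-or-prime E p²∈S
  ... | inj₁ p²≤K = <⇒≱ K<p² p²≤K
  ... | inj₂ pp² = ¬prime-square pp pp²
  below : ∀ {n} → S E n → n ≤ p ^ 2 → φ n ≤ φ (p ^ 2)
  below n∈S = φ≤φ-square pp gap (map₁ (λ n≤K → ≤-trans n≤K K≤[p-1]²) (bounded-or-prime E n∈S))
  above : ∀ {m} → S E m → p ^ 2 ≤ m → φ (p ^ 2) ≤ φ m
  above m∈S p²≤m with bounded-or-prime E m∈S
  ... | inj₁ m≤K = contradiction (≤-trans p²≤m m≤K) (<⇒≱ K<p²)
  ... | inj₂ pm = φ-square≤φ pp pm p²≤m
  bounded-or-prime′ : ∀ {n} → (S E ∪ ｛ p ^ 2 ｝) n → n ≤ p ^ 2 ⊎ Prime n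
  bounded-or-prime′ (inj₁ n∈S) = map₁ (λ n≤K → ≤-trans n≤K (<⇒≤ K<p²)) (bounded-or-prime E n∈S)
  bounded-or-prime′ (inj₂ refl) = inj₁ ≤-refl
  excess′ : ∀ {x} → threshold E ⊔ p ^ 2 ≤ x → π x + suc B ≤ count (S? E ∪? (p ^ 2 ≟_)) x
  excess′ {x} x≥ = begin
    π x + suc B                  ≡⟨ +-suc (π x) B ⟩
    suc (π x + B)                ≤⟨ s≤s (excess E (≤-trans (m≤m⊔n _ _) x≥)) ⟩
    suc (count (S? E) x)         ≤⟨ count-insert (S? E) p²∉S (m^n>0 p 2) (≤-trans (m≤n⊔m _ _) x≥) ⟩
    count (S? E ∪? (p ^ 2 ≟_)) x ∎
    where open ≤-Reasoning

monotoneExcess : (∀ N → ∃[ p ] (N ≤ p × Prime p × NoPrimeBetween ((p ∸ 1) ^ 2) (p ^ 2))) →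
  ∀ B → MonotoneExcess B
monotoneExcess gaps zero = primes
monotoneExcess gaps (suc B) =
  let E = monotoneExcess gaps B
      (p , K<p , pp , gap) = gaps (suc (bound E))
  in insert-square E K<p pp gap

proposition4p1 :
    (∀ (N : ℕ) → ∃[ p ] (N ≤ p × Prime p ×
        (∀ (q : ℕ) → (p ∸ 1) ^ 2 < q → q < p ^ 2 → ¬ Prime q))) →
    ∀ (B : ℕ) → ∃[ X ] ∀ (x : ℕ) → X ≤ x → π x + B ≤ M x
proposition4p1 gaps B =
  threshold E , λ x X≤x → ≤-trans (excess E X≤x) (count≤M (S? E) (φ-monotone E) x)
  where E = monotoneExcess gaps B
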